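{- Let $G$ be a clique-grid graph with representation $f:V(G)\to[t]\times[t']$ and let $k\in\mathbb{N}$. If $G$ contains $k$ pairwise vertex-disjoint cycles, then $G$ contains a set $\mathcal{C}$ of $k$ pairwise vertex-disjoint induced cycles such that for every cell $(i,j)\in[t]\times[t']$, $|\mathrm{cross}(\mathcal{C},i,j)|\le 2304$.
   Context: A graph $G$ is a clique-grid graph with representation $f:V(G)\to[t]\times[t']$ if (1) for every cell $(i,j)$, $f^{ -1}(i,j)$ is a clique, and (2) for every edge $\{u,v\}$ with $f(u)=(i,j)$, $f(v)=(i',j')$, $|i-i'|\le 2$ and $|j-j'|\le 2$. For a cycle $C$, $\mathrm{cross}(C)=\{\{u,v\}\in E(C): f(u)\ne f(v)\}$; for a set $\mathcal{C}$ of cycles, $\mathrm{cross}(\mathcal{C})=\bigcup_{C\in\mathcal{C}}\mathrm{cross}(C)$, and $\mathrm{cross}(\mathcal{C},i,j)$ is the set of vertices of $f^{ -1}(i,j)$ that are endpoints of edges in $\mathrm{cross}(\mathcal{C})$. -}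

module Defs where

open import Data.Nat using (ℕ; zero; suc; _+_; _≤_; _<_; ∣_-_∣; _%_)
open import Data.Nat.DivMod using (m%n<n)
open import Data.Bool using (Bool; T)
open import Data.Fin using (Fin; toℕ; fromℕ<)
open import Data.Product using (_×_; _,_; ∃; Σ)
open import Data.Sum using (_⊎_)
open import Data.List using (List; length)
open import Data.List.Relation.Unary.All using (All)
open import Data.List.Relation.Unary.Unique.Propositional using (Unique)
open import Relation.Binary.PropositionalEquality using (_≡_; _≢_)
open import Relation.Nullary using (¬_)

record Graph (n : ℕ) : Set where
  field
    adj    : Fin n → Fin n → Bool
    sym    : ∀ u v → adj u v ≡ adj v u
    irrefl : ∀ v → adj v v ≡ Bool.false
  Adj : Fin n → Fin n → Set
  Adj u v = T (adj u v)
open Graph public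

Cell : ℕ → ℕ → Set
Cell t t' = Fin t × Fin t'

record IsCliqueGrid {n : ℕ} (G : Graph n) (t t' : ℕ) (f : Fin n → Cell t t') : Set where
  field
    clique : ∀ u v → u ≢ v → f u ≡ f v → Adj G u v
    local  : ∀ u v → Adj G u v →
               (∣ toℕ (Data.Product.proj₁ (f u)) - toℕ (Data.Product.proj₁ (f v)) ∣ ≤ 2)
             × (∣ toℕ (Data.Product.proj₂ (f u)) - toℕ (Data.Product.proj₂ (f v)) ∣ ≤ 2)

next : ∀ {m} → Fin (suc m) → Fin (suc m)
next {m} i = fromℕ< (m%n<n (suc (toℕ i)) (suc m))

record Cycle {n : ℕ} (G : Graph n) : Set where
  field
    ℓ    : ℕ
    vert : Fin (3 + ℓ) → Fin n
    inj  : ∀ i j → vert i ≡ vert j → i ≡ j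
    edge : ∀ i → Adj G (vert i) (vert (next i))
open Cycle public

Induced : ∀ {n} {G : Graph n} → Cycle G → Set
Induced {G = G} C = ∀ i j → Adj G (vert C i) (vert C j) → (j ≡ next i) ⊎ (i ≡ next j)

Disjoint : ∀ {n} {G : Graph n} {k : ℕ} → (Fin k → Cycle G) → Set
Disjoint {k = k} 𝒞 = ∀ a b → a ≢ b → ∀ i j → ¬ (vert (𝒞 a) i ≡ vert (𝒞 b) j)

CrossEndpoint : ∀ {n t t'} {G : Graph n} → (Fin n → Cell t t') → Cycle G → Fin n → Set
CrossEndpoint f C v =
  ∃ λ i → (f (vert C i) ≢ f (vert C (next i)))
        × ((v ≡ vert C i) ⊎ (v ≡ vert C (next i)))

-- v ∈ cross(𝒞, c): v ∈ f⁻¹(c) and v is an endpoint of an edge of cross(𝒞).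
InCross : ∀ {n t t' k} {G : Graph n} → (Fin n → Cell t t') → (Fin k → Cycle G)
        → Cell t t' → Fin n → Set
InCross f 𝒞 c v = (f v ≡ c) × ∃ λ a → CrossEndpoint f (𝒞 a) v

-- |S| ≤ b for a set S ⊆ Fin n given by a predicate: every duplicate-free list of members has length ≤ b.
CardLe : ∀ {n} → (Fin n → Set) → ℕ → Set
CardLe {n} P b = ∀ (xs : List (Fin n)) → Unique xs → All P xs → length xs ≤ b

module Submission where

-- Give a cycle of length 3 + ℓ the weight 2ℓ + [it is not monochromatic], and a family
-- of cycles the total weight Φ.  A disjoint family can be improved to a disjoint family
-- of strictly smaller Φ unless it is already good:
--   * a chord of one cycle cuts out a strictly shorter cycle on its vertices (the
--     length drop pays for the possible new non-monochromatic bit);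
--   * if three distinct cycles cross the boundary of their cells at vertices with the
--     same cell pattern (cells of predecessor, vertex, successor), the three vertices
--     at each offset form a monochromatic triangle (cells are cliques), and the three
--     triangles, of weight 0, replace the three cycles, of weight ≥ 1.
-- In a family with neither configuration every cycle is induced, and every vertex of
-- cross(𝒞, c) is a crossing position of its cycle whose neighbours lie in two of the
-- 25 cells near c.  Two such positions of one induced cycle have different patterns, and
-- three on distinct cycles would be a bad triple, so by pigeonhole over the 25² patterns
-- there are at most 1250 ≤ 2304 of them.  Well-founded recursion on Φ concludes.

open import Defs hiding (sym)
open import Data.Bool using (T)
open import Data.Empty using (⊥; ⊥-elim)
open import Data.Fin using (Fin; zero; suc; toℕ; fromℕ; fromℕ<; inject₁; combine)
  renaming (_≟_ to _≟ᶠ_)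
open import Data.Fin.Patterns using (0F; 1F; 2F)
open import Data.Fin.Properties
  using (toℕ-injective; toℕ-fromℕ<; toℕ-fromℕ; toℕ-inject₁; toℕ<n; inject₁ℕ<;
         combine-injective; 0≢1+n; any?; all?)
  renaming (suc-injective to Fin-suc-injective)
open import Data.List using (List; []; _∷_; length; filter)
open import Data.List.Relation.Unary.All as All using (All; []; _∷_; reduce)
open import Data.List.Relation.Unary.All.Properties using (all-filter)
  renaming (filter⁺ to All-filter⁺)
open import Data.List.Relation.Unary.AllPairs using (AllPairs; []; _∷_)
open import Data.List.Relation.Unary.AllPairs.Properties using ()
  renaming (filter⁺ to AllPairs-filter⁺)
open import Data.Nat using (ℕ; zero; suc; _+_; _*_; _∸_; _≤_; _<_; z≤n; s≤s; s≤s⁻¹; _%_; ∣_-_∣)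
  renaming (_≟_ to _≟ℕ_)
open import Data.Nat.DivMod using (m%n<n; m<n⇒m%n≡m; n%n≡0)
open import Data.Nat.Induction using (<-wellFounded)
open import Data.Nat.Properties
  using (≤-refl; ≤-trans; <⇒≤; ≤-<-trans; ≤∧≢⇒<; <-cmp; 1+n≢n; m≢1+n+m;
         n<1+n; m≤m+n; m≤n+m; m≤n+m∸n; m∸n≤∣m-n∣; m+[n∸m]≡n; m∸n+n≡m; m+n∸m≡n;
         +-comm; +-assoc; +-suc; +-identityʳ; +-cancelˡ-≡; +-cancelʳ-≡; ∣-∣-comm;
         +-mono-≤; +-monoʳ-≤; +-monoˡ-≤; +-monoʳ-<; +-mono-<-≤; +-mono-≤-<;
         *-monoʳ-≤; *-suc; ∸-monoˡ-≤; module ≤-Reasoning)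
open import Data.Product using (Σ; Σ-syntax; ∃; _×_; _,_; proj₁; proj₂)
open import Data.Product.Properties using (≡-dec)
open import Data.Sum using (_⊎_; inj₁; inj₂)
open import Induction.WellFounded using (Acc; acc)
open import Relation.Binary using (tri<; tri≈; tri>)
open import Relation.Binary.PropositionalEquality
  using (_≡_; _≢_; refl; sym; trans; cong; cong₂; subst; subst₂; module ≡-Reasoning)
open import Relation.Nullary using (¬_; Dec; yes; no)
open import Relation.Nullary.Decidable using (map′; T?; ¬?; _×-dec_)
open import Relation.Unary using (Decidable)
open import Relation.Unary.Properties using (∁?)

data Position {m : ℕ} : Fin (suc m) → Set where
  inner : (j : Fin m) → Position (inject₁ j)
  last  : Position (fromℕ m)

position : ∀ {m} (i : Fin (suc m)) → Position i
position {zero}  zero    = last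
position {suc m} zero    = inner zero
position {suc m} (suc i) with position i
... | inner j = inner (suc j)
... | last    = last

toℕ-next : ∀ {m} (i : Fin (suc m)) → toℕ (next i) ≡ suc (toℕ i) % suc m
toℕ-next {m} i = toℕ-fromℕ< (m%n<n (suc (toℕ i)) (suc m))

toℕ-next-< : ∀ {m} (i : Fin (suc m)) → suc (toℕ i) < suc m → toℕ (next i) ≡ suc (toℕ i)
toℕ-next-< i lt = trans (toℕ-next i) (m<n⇒m%n≡m lt)

next-inject₁ : ∀ {m} (j : Fin m) → next (inject₁ j) ≡ suc j
next-inject₁ j = toℕ-injective (begin
  toℕ (next (inject₁ j))  ≡⟨ toℕ-next-< (inject₁ j) (s≤s (inject₁ℕ< j)) ⟩
  suc (toℕ (inject₁ j))   ≡⟨ cong suc (toℕ-inject₁ j) ⟩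
  suc (toℕ j)             ∎)
  where open ≡-Reasoning

next-fromℕ : ∀ m → next (fromℕ m) ≡ zero
next-fromℕ m = toℕ-injective (begin
  toℕ (next (fromℕ m))         ≡⟨ toℕ-next (fromℕ m) ⟩
  suc (toℕ (fromℕ m)) % suc m  ≡⟨ cong (λ x → suc x % suc m) (toℕ-fromℕ m) ⟩
  suc m % suc m                ≡⟨ n%n≡0 (suc m) ⟩
  0                            ∎)
  where open ≡-Reasoning

prev : ∀ {m} → Fin (suc m) → Fin (suc m)
prev {m} zero    = fromℕ m
prev     (suc j) = inject₁ j

next-prev : ∀ {m} (i : Fin (suc m)) → next (prev i) ≡ i
next-prev {m} zero    = next-fromℕ m
next-prev     (suc j) = next-inject₁ j

prev-next : ∀ {m} (i : Fin (suc m)) → prev (next i) ≡ i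
prev-next i with position i
... | inner j = cong prev (next-inject₁ j)
... | last    = cong prev (next-fromℕ _)

suc≢inject₁ : ∀ {m} (j : Fin m) → suc j ≢ inject₁ j
suc≢inject₁ j e = 1+n≢n (trans (cong toℕ e) (toℕ-inject₁ j))

next≢ : ∀ {m} (i : Fin (2 + m)) → next i ≢ i
next≢ i with position i
... | inner j = λ e → suc≢inject₁ j (trans (sym (next-inject₁ j)) e)
... | last    = λ e → 0≢1+n (trans (sym (next-fromℕ _)) e)

next²≢ : ∀ {m} (i : Fin (3 + m)) → next (next i) ≢ i
next²≢ {m} i with position i
... | last = λ e → 0≢1+n (Fin-suc-injective (begin
  suc zero                     ≡⟨ sym (next-inject₁ zero) ⟩
  next zero                    ≡⟨ cong next (sym (next-fromℕ (2 + m))) ⟩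
  next (next (fromℕ (2 + m)))  ≡⟨ e ⟩
  fromℕ (2 + m)                ∎))
  where open ≡-Reasoning
... | inner j with position j
...   | inner j′ = λ e → m≢1+n+m (toℕ j′) (sym (begin
  suc (suc (toℕ j′))                  ≡⟨ cong toℕ (sym (next-inject₁ (suc j′))) ⟩
  toℕ (next (suc (inject₁ j′)))       ≡⟨ cong (λ x → toℕ (next x)) (sym (next-inject₁ (inject₁ j′))) ⟩
  toℕ (next (next (inject₁ (inject₁ j′)))) ≡⟨ cong toℕ e ⟩
  toℕ (inject₁ (inject₁ j′))          ≡⟨ trans (toℕ-inject₁ (inject₁ j′)) (toℕ-inject₁ j′) ⟩
  toℕ j′                              ∎))
  where open ≡-Reasoning
...   | last = λ e → 0≢1+n (begin
  zero                                  ≡⟨ sym (next-fromℕ (2 + m)) ⟩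
  next (fromℕ (2 + m))                  ≡⟨ cong next (sym (next-inject₁ (fromℕ (suc m)))) ⟩
  next (next (inject₁ (fromℕ (suc m)))) ≡⟨ e ⟩
  inject₁ (fromℕ (suc m))               ∎)
  where open ≡-Reasoning

prev≢ : ∀ {m} (i : Fin (2 + m)) → prev i ≢ i
prev≢ i e = next≢ i (trans (cong next (sym e)) (next-prev i))

prev≢next : ∀ {m} (i : Fin (3 + m)) → prev i ≢ next i
prev≢next i e = next²≢ i (trans (cong next (sym e)) (next-prev i))

fin3-injective : ∀ {A : Set} (g : Fin 3 → A) → g 0F ≢ g 1F → g 0F ≢ g 2F → g 1F ≢ g 2F →
                 ∀ q q′ → g q ≡ g q′ → q ≡ q′
fin3-injective g g01 g02 g12 0F 0F _ = refl
fin3-injective g g01 g02 g12 0F 1F e = ⊥-elim (g01 e)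
fin3-injective g g01 g02 g12 0F 2F e = ⊥-elim (g02 e)
fin3-injective g g01 g02 g12 1F 0F e = ⊥-elim (g01 (sym e))
fin3-injective g g01 g02 g12 1F 1F _ = refl
fin3-injective g g01 g02 g12 1F 2F e = ⊥-elim (g12 e)
fin3-injective g g01 g02 g12 2F 0F e = ⊥-elim (g02 (sym e))
fin3-injective g g01 g02 g12 2F 1F e = ⊥-elim (g12 (sym e))
fin3-injective g g01 g02 g12 2F 2F _ = refl

around : ∀ {m} → Fin 3 → Fin (suc m) → Fin (suc m)
around 0F p = prev p
around 1F p = p
around 2F p = next p

around-injective : ∀ {m} (p : Fin (3 + m)) → ∀ r r′ → around r p ≡ around r′ p → r ≡ r′
around-injective p = fin3-injective (λ r → around r p) (prev≢ p) (prev≢next p) (λ e → next≢ p (sym e))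

∑ : ∀ {k} → (Fin k → ℕ) → ℕ
∑ {zero}  g = 0
∑ {suc k} g = g zero + ∑ (λ b → g (suc b))

∑-mono-≤ : ∀ {k} {g h : Fin k → ℕ} → (∀ b → g b ≤ h b) → ∑ g ≤ ∑ h
∑-mono-≤ {zero}  g≤h = z≤n
∑-mono-≤ {suc k} g≤h = +-mono-≤ (g≤h zero) (∑-mono-≤ (λ b → g≤h (suc b)))

∑-mono-< : ∀ {k} {g h : Fin k → ℕ} → (∀ b → g b ≤ h b) → ∀ a → g a < h a → ∑ g < ∑ h
∑-mono-< {suc k} g≤h zero    lt = +-mono-<-≤ lt (∑-mono-≤ (λ b → g≤h (suc b)))
∑-mono-< {suc k} g≤h (suc a) lt = +-mono-≤-< (g≤h zero) (∑-mono-< (λ b → g≤h (suc b)) a lt)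

length-filter-∁ : ∀ {A : Set} {P : A → Set} (P? : Decidable P) (xs : List A) →
                  length xs ≡ length (filter P? xs) + length (filter (∁? P?) xs)
length-filter-∁ P? [] = refl
length-filter-∁ P? (x ∷ xs) with P? x
... | yes _ = cong suc (length-filter-∁ P? xs)
... | no  _ = trans (cong suc (length-filter-∁ P? xs)) (sym (+-suc _ _))

module Pigeonhole {A : Set} (R : A → A → Set) (key : A → ℕ)
  (noThree : ∀ x y z → R x y → R x z → R y z → key x ≡ key y → key x ≡ key z → ⊥) where

  atMostTwo : ∀ {m} xs → AllPairs R xs → All (λ x → key x ≡ m) xs → length xs ≤ 2
  atMostTwo [] _ _ = z≤n
  atMostTwo (_ ∷ []) _ _ = s≤s z≤n
  atMostTwo (_ ∷ _ ∷ []) _ _ = s≤s (s≤s z≤n)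
  atMostTwo (x ∷ y ∷ z ∷ _) ((rxy ∷ rxz ∷ _) ∷ (ryz ∷ _) ∷ _) (kx ∷ ky ∷ kz ∷ _) =
    ⊥-elim (noThree x y z rxy rxz ryz (trans kx (sym ky)) (trans kx (sym kz)))

  -- Induction on N: at most two elements have the key N - 1, the rest have keys below it.
  pigeonhole : ∀ N xs → AllPairs R xs → All (λ x → key x < N) xs → length xs ≤ N * 2
  pigeonhole zero [] _ _ = z≤n
  pigeonhole zero (_ ∷ _) _ (() ∷ _)
  pigeonhole (suc N) xs related bounded = begin
    length xs                      ≡⟨ length-filter-∁ top? xs ⟩
    length tops + length rest      ≤⟨ +-mono-≤ atMostTwo-tops (pigeonhole N rest restRelated restBounded) ⟩
    2 + N * 2                      ∎
    where
    open ≤-Reasoning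
    top? : Decidable (λ x → key x ≡ N)
    top? x = key x ≟ℕ N
    tops rest : List A
    tops = filter top? xs
    rest = filter (∁? top?) xs
    atMostTwo-tops : length tops ≤ 2
    atMostTwo-tops = atMostTwo tops (AllPairs-filter⁺ top? related) (all-filter top? xs)
    restRelated : AllPairs R rest
    restRelated = AllPairs-filter⁺ (∁? top?) related
    restBounded : All (λ x → key x < N) rest
    restBounded = All.zipWith (λ (≢N , <1+N) → ≤∧≢⇒< (s≤s⁻¹ <1+N) ≢N)
                              (all-filter (∁? top?) xs , All-filter⁺ (∁? top?) bounded)

-- A number u within distance 2 of c is recorded by its offset u + 2 ∸ c < 5.
module _ (c u : ℕ) (close : ∣ u - c ∣ ≤ 2) where

  u≤c+2 : u ≤ c + 2
  u≤c+2 = ≤-trans (m≤n+m∸n u c) (+-monoʳ-≤ c (≤-trans (m∸n≤∣m-n∣ u c) close))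

  c≤u+2 : c ≤ u + 2
  c≤u+2 = ≤-trans (m≤n+m∸n c u)
            (+-monoʳ-≤ u (≤-trans (m∸n≤∣m-n∣ c u) (subst (_≤ 2) (∣-∣-comm u c) close)))

  offset<5 : u + 2 ∸ c < 5
  offset<5 = s≤s (begin
    u + 2 ∸ c      ≤⟨ ∸-monoˡ-≤ c (+-monoˡ-≤ 2 u≤c+2) ⟩
    c + 2 + 2 ∸ c  ≡⟨ cong (_∸ c) (+-assoc c 2 2) ⟩
    c + 4 ∸ c      ≡⟨ m+n∸m≡n c 4 ⟩
    4              ∎)
    where open ≤-Reasoning

offset-injective : ∀ c u v → ∣ u - c ∣ ≤ 2 → ∣ v - c ∣ ≤ 2 → u + 2 ∸ c ≡ v + 2 ∸ c → u ≡ v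
offset-injective c u v cu cv e = +-cancelʳ-≡ 2 u v (begin
  u + 2            ≡⟨ sym (m∸n+n≡m (c≤u+2 c u cu)) ⟩
  (u + 2 ∸ c) + c  ≡⟨ cong (_+ c) e ⟩
  (v + 2 ∸ c) + c  ≡⟨ m∸n+n≡m (c≤u+2 c v cv) ⟩
  v + 2            ∎)
  where open ≡-Reasoning

Near : ∀ {t t′} → Cell t t′ → Cell t t′ → Set
Near c u = (∣ toℕ (proj₁ u) - toℕ (proj₁ c) ∣ ≤ 2) × (∣ toℕ (proj₂ u) - toℕ (proj₂ c) ∣ ≤ 2)

coordCode : ∀ {s} (c u : Fin s) → ∣ toℕ u - toℕ c ∣ ≤ 2 → Fin 5
coordCode c u close = fromℕ< (offset<5 (toℕ c) (toℕ u) close)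

coordCode-injective : ∀ {s} (c u v : Fin s) (cu : ∣ toℕ u - toℕ c ∣ ≤ 2)
                      (cv : ∣ toℕ v - toℕ c ∣ ≤ 2) → coordCode c u cu ≡ coordCode c v cv → u ≡ v
coordCode-injective c u v cu cv e =
  toℕ-injective (offset-injective (toℕ c) (toℕ u) (toℕ v) cu cv (begin
  toℕ u + 2 ∸ toℕ c        ≡⟨ sym (toℕ-fromℕ< (offset<5 (toℕ c) (toℕ u) cu)) ⟩
  toℕ (coordCode c u cu)   ≡⟨ cong toℕ e ⟩
  toℕ (coordCode c v cv)   ≡⟨ toℕ-fromℕ< (offset<5 (toℕ c) (toℕ v) cv) ⟩
  toℕ v + 2 ∸ toℕ c        ∎))
  where open ≡-Reasoning

cellCode : ∀ {t t′} (c u : Cell t t′) → Near c u → Fin 25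
cellCode (c₁ , c₂) (u₁ , u₂) (near₁ , near₂) =
  combine (coordCode c₁ u₁ near₁) (coordCode c₂ u₂ near₂)

cellCode-injective : ∀ {t t′} (c u v : Cell t t′) (nu : Near c u) (nv : Near c v) →
                     cellCode c u nu ≡ cellCode c v nv → u ≡ v
cellCode-injective (c₁ , c₂) (u₁ , u₂) (v₁ , v₂) (nu₁ , nu₂) (nv₁ , nv₂) e
  with combine-injective (coordCode c₁ u₁ nu₁) (coordCode c₂ u₂ nu₂)
                         (coordCode c₁ v₁ nv₁) (coordCode c₂ v₂ nv₂) e
... | e₁ , e₂ = cong₂ _,_ (coordCode-injective c₁ u₁ v₁ nu₁ nv₁ e₁)
                          (coordCode-injective c₂ u₂ v₂ nu₂ nv₂ e₂)

module _ {n : ℕ} {G : Graph n} where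

  adj-sym : ∀ {u v} → Adj G u v → Adj G v u
  adj-sym {u} {v} = subst T (Graph.sym G u v)

  adj-irrefl : ∀ v → ¬ Adj G v v
  adj-irrefl v = subst T (Graph.irrefl G v)

  edge-prev : (C : Cycle G) (p : Fin (3 + ℓ C)) → Adj G (vert C (prev p)) (vert C p)
  edge-prev C p = subst (λ x → Adj G (vert C (prev p)) (vert C x)) (next-prev p) (edge C (prev p))

  _⊆ᵥ_ : Cycle G → Cycle G → Set
  C′ ⊆ᵥ C = ∀ r → ∃ λ s → vert C′ r ≡ vert C s

  Shortening : Cycle G → Set
  Shortening C = Σ (Cycle G) λ C′ → ℓ C′ < ℓ C × C′ ⊆ᵥ C

  triangle : (v : Fin 3 → Fin n) → (∀ q q′ → v q ≡ v q′ → q ≡ q′) →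
             (∀ q q′ → q ≢ q′ → Adj G (v q) (v q′)) → Cycle G
  triangle v v-injective v-adjacent = record
    { ℓ = 0 ; vert = v ; inj = v-injective
    ; edge = λ q → v-adjacent q (next q) (λ e → next≢ q (sym e)) }

  -- If positions i and j, with toℕ j = toℕ i + 2 + e, are adjacent, then the arc
  -- i, i + 1, …, j of C closed by the edge {j, i} is a cycle of length 3 + e.
  module Arc (C : Cycle G) (i j : Fin (3 + ℓ C)) (e : ℕ) (i+2+e≡j : toℕ i + (2 + e) ≡ toℕ j)
             (chord : Adj G (vert C i) (vert C j)) where

    pos< : ∀ (r : Fin (3 + e)) → toℕ i + toℕ r < 3 + ℓ C
    pos< r = ≤-<-trans (+-monoʳ-≤ (toℕ i) (s≤s⁻¹ (toℕ<n r)))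
                       (subst (_< 3 + ℓ C) (sym i+2+e≡j) (toℕ<n j))

    pos : Fin (3 + e) → Fin (3 + ℓ C)
    pos r = fromℕ< (pos< r)

    toℕ-pos : ∀ r → toℕ (pos r) ≡ toℕ i + toℕ r
    toℕ-pos r = toℕ-fromℕ< (pos< r)

    pos-injective : ∀ r r′ → pos r ≡ pos r′ → r ≡ r′
    pos-injective r r′ e = toℕ-injective (+-cancelˡ-≡ (toℕ i) _ _
      (trans (sym (toℕ-pos r)) (trans (cong toℕ e) (toℕ-pos r′))))

    pos-first : pos zero ≡ i
    pos-first = toℕ-injective (trans (toℕ-pos zero) (+-identityʳ (toℕ i)))

    pos-last : pos (fromℕ (2 + e)) ≡ j
    pos-last = toℕ-injective (trans (toℕ-pos _) (trans (cong (toℕ i +_) (toℕ-fromℕ (2 + e))) i+2+e≡j))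

    pos-step : ∀ (s : Fin (2 + e)) → next (pos (inject₁ s)) ≡ pos (suc s)
    pos-step s = toℕ-injective (trans (toℕ-next-< (pos (inject₁ s)) lt) one-more)
      where
      open ≡-Reasoning
      one-more : suc (toℕ (pos (inject₁ s))) ≡ toℕ (pos (suc s))
      one-more = begin
        suc (toℕ (pos (inject₁ s)))    ≡⟨ cong suc (toℕ-pos (inject₁ s)) ⟩
        suc (toℕ i + toℕ (inject₁ s))  ≡⟨ cong (λ x → suc (toℕ i + x)) (toℕ-inject₁ s) ⟩
        suc (toℕ i + toℕ s)            ≡⟨ sym (+-suc (toℕ i) (toℕ s)) ⟩
        toℕ i + suc (toℕ s)            ≡⟨ sym (toℕ-pos (suc s)) ⟩
        toℕ (pos (suc s))              ∎
      lt : suc (toℕ (pos (inject₁ s))) < 3 + ℓ C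
      lt = subst (_< 3 + ℓ C) (sym one-more) (toℕ<n (pos (suc s)))

    -- consecutive arc positions are adjacent: along C, or across the chord at the end
    pos-edge : ∀ r → Adj G (vert C (pos r)) (vert C (pos (next r)))
    pos-edge r with position r
    ... | inner s = subst (λ x → Adj G (vert C (pos (inject₁ s))) (vert C x))
                          (trans (pos-step s) (cong pos (sym (next-inject₁ s))))
                          (edge C (pos (inject₁ s)))
    ... | last    = subst₂ (λ x y → Adj G (vert C x) (vert C y))
                           (sym pos-last) (sym (trans (cong pos (next-fromℕ (2 + e))) pos-first))
                           (adj-sym chord)

    arc : Cycle G
    arc = record { ℓ = e ; vert = λ r → vert C (pos r)
                 ; inj = λ r r′ h → pos-injective r r′ (inj C _ _ h) ; edge = pos-edge }

    arc-⊆ : arc ⊆ᵥ C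
    arc-⊆ r = pos r , refl

  arc-shorter : ∀ a b L e → a + (2 + e) ≡ b → b < 3 + L → (a ≡ 0 → b ≢ 2 + L) → e < L
  arc-shorter zero    b L e refl b< notAll = s≤s⁻¹ (s≤s⁻¹ (≤∧≢⇒< (s≤s⁻¹ b<) (notAll refl)))
  arc-shorter (suc a) b L e refl b< _      =
    s≤s⁻¹ (s≤s⁻¹ (≤-trans (s≤s (m≤n+m (2 + e) a)) (s≤s⁻¹ b<)))

  IsChord : (C : Cycle G) → Fin (3 + ℓ C) → Fin (3 + ℓ C) → Set
  IsChord C i j = Adj G (vert C i) (vert C j) × j ≢ next i × i ≢ next j

  chord-arc : (C : Cycle G) (i j : Fin (3 + ℓ C)) → IsChord C i j → toℕ i < toℕ j → Shortening C
  chord-arc C i j (chord , j≢next-i , i≢next-j) i<j =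
    Arc.arc C i j e i+2+e≡j chord , e<ℓ , Arc.arc-⊆ C i j e i+2+e≡j chord
    where
    i+2≤j : toℕ i + 2 ≤ toℕ j
    i+2≤j = subst (_≤ toℕ j) (+-comm 2 (toℕ i)) (≤∧≢⇒< i<j λ i+1≡j →
      j≢next-i (toℕ-injective (trans (sym i+1≡j) (sym (toℕ-next-< i (≤-<-trans i<j (toℕ<n j)))))))
    e : ℕ
    e = toℕ j ∸ (toℕ i + 2)
    i+2+e≡j : toℕ i + (2 + e) ≡ toℕ j
    i+2+e≡j = trans (sym (+-assoc (toℕ i) 2 e)) (m+[n∸m]≡n i+2≤j)
    notAll : toℕ i ≡ 0 → toℕ j ≢ 2 + ℓ C
    notAll i≡0 j≡last = i≢next-j (trans (toℕ-injective i≡0)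
      (sym (trans (cong next (toℕ-injective (trans j≡last (sym (toℕ-fromℕ _))))) (next-fromℕ _))))
    e<ℓ : e < ℓ C
    e<ℓ = arc-shorter (toℕ i) (toℕ j) (ℓ C) e i+2+e≡j (toℕ<n j) notAll

  chord⇒shortening : (C : Cycle G) (i j : Fin (3 + ℓ C)) → IsChord C i j → Shortening C
  chord⇒shortening C i j ch@(chord , j≢next-i , i≢next-j) with <-cmp (toℕ i) (toℕ j)
  ... | tri< i<j _ _ = chord-arc C i j ch i<j
  ... | tri≈ _ i≡j _ =
    ⊥-elim (adj-irrefl _ (subst (λ x → Adj G (vert C i) (vert C x)) (toℕ-injective (sym i≡j)) chord))
  ... | tri> _ _ j<i = chord-arc C j i (adj-sym chord , i≢next-j , j≢next-i) j<i

module CliqueGrid {n t t′ : ℕ} (G : Graph n) (f : Fin n → Cell t t′) (grid : IsCliqueGrid G t t′ f)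
                  (k : ℕ) where

  open IsCliqueGrid grid

  _≟ᶜ_ : (u v : Cell t t′) → Dec (u ≡ v)
  _≟ᶜ_ = ≡-dec _≟ᶠ_ _≟ᶠ_

  cellsAround : (C : Cycle G) → Fin (3 + ℓ C) → Fin 3 → Cell t t′
  cellsAround C p r = f (vert C (around r p))

  Crossing : (Fin 3 → Cell t t′) → Set
  Crossing π = ¬ (π 0F ≡ π 1F × π 2F ≡ π 1F)

  crossing? : ∀ π → Dec (Crossing π)
  crossing? π = ¬? ((π 0F ≟ᶜ π 1F) ×-dec (π 2F ≟ᶜ π 1F))

  SamePattern : (C C′ : Cycle G) → Fin (3 + ℓ C) → Fin (3 + ℓ C′) → Set
  SamePattern C C′ p p′ = ∀ r → cellsAround C p r ≡ cellsAround C′ p′ r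

  samePattern? : ∀ C C′ p p′ → Dec (SamePattern C C′ p p′)
  samePattern? C C′ p p′ = all? (λ r → cellsAround C p r ≟ᶜ cellsAround C′ p′ r)

  Mono : Cycle G → Set
  Mono C = ∀ r → f (vert C r) ≡ f (vert C zero)

  mono? : ∀ C → Dec (Mono C)
  mono? C = all? (λ r → f (vert C r) ≟ᶜ f (vert C zero))

  crossing⇒¬mono : ∀ C p → Crossing (cellsAround C p) → ¬ Mono C
  crossing⇒¬mono C p cr mono = cr (trans (mono _) (sym (mono _)) , trans (mono _) (sym (mono _)))

  defect : Cycle G → ℕ
  defect C with mono? C
  ... | yes _ = 0
  ... | no  _ = 1

  weight : Cycle G → ℕ
  weight C = 2 * ℓ C + defect C

  defect≤1 : ∀ C → defect C ≤ 1
  defect≤1 C with mono? C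
  ... | yes _ = z≤n
  ... | no  _ = s≤s z≤n

  mono-weight : ∀ C → Mono C → weight C ≡ 2 * ℓ C
  mono-weight C mono with mono? C
  ... | yes _    = +-identityʳ _
  ... | no ¬mono = ⊥-elim (¬mono mono)

  ¬mono-weight : ∀ C → ¬ Mono C → 0 < weight C
  ¬mono-weight C ¬mono with mono? C
  ... | yes mono = ⊥-elim (¬mono mono)
  ... | no  _    = m≤n+m 1 (2 * ℓ C)

  -- A drop in length outweighs the defect bit.
  shorter⇒lighter : ∀ C C′ → ℓ C′ < ℓ C → weight C′ < weight C
  shorter⇒lighter C C′ ℓ′<ℓ = begin-strict
    2 * ℓ C′ + defect C′  ≤⟨ +-monoʳ-≤ (2 * ℓ C′) (defect≤1 C′) ⟩
    2 * ℓ C′ + 1          <⟨ +-monoʳ-< (2 * ℓ C′) (n<1+n 1) ⟩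
    2 * ℓ C′ + 2          ≡⟨ trans (+-comm (2 * ℓ C′) 2) (sym (*-suc 2 (ℓ C′))) ⟩
    2 * suc (ℓ C′)        ≤⟨ *-monoʳ-≤ 2 ℓ′<ℓ ⟩
    2 * ℓ C               ≤⟨ m≤m+n (2 * ℓ C) (defect C) ⟩
    weight C              ∎
    where open ≤-Reasoning

  Family : Set
  Family = Fin k → Cycle G

  Φ : Family → ℕ
  Φ 𝒞 = ∑ (λ a → weight (𝒞 a))

  Improvement : Family → Set
  Improvement 𝒞 = Σ Family λ 𝒞′ → Disjoint 𝒞′ × Φ 𝒞′ < Φ 𝒞

  Chord : Family → Set
  Chord 𝒞 = Σ[ a ∈ Fin k ] Σ[ i ∈ Fin (3 + ℓ (𝒞 a)) ] Σ[ j ∈ Fin (3 + ℓ (𝒞 a)) ]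
              IsChord (𝒞 a) i j

  chord? : ∀ 𝒞 → Dec (Chord 𝒞)
  chord? 𝒞 = any? λ a → any? λ i → any? λ j →
    T? (adj G (vert (𝒞 a) i) (vert (𝒞 a) j)) ×-dec ¬? (j ≟ᶠ next i) ×-dec ¬? (i ≟ᶠ next j)

  chordless⇒induced : ∀ 𝒞 → ¬ Chord 𝒞 → ∀ a → Induced (𝒞 a)
  chordless⇒induced 𝒞 chordless a i j adjacent with j ≟ᶠ next i | i ≟ᶠ next j
  ... | yes j≡next-i | _            = inj₁ j≡next-i
  ... | no  _        | yes i≡next-j = inj₂ i≡next-j
  ... | no  j≢next-i | no  i≢next-j = ⊥-elim (chordless (a , i , j , adjacent , j≢next-i , i≢next-j))

  _[_≔_] : Family → Fin k → Cycle G → Family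
  (𝒞 [ a ≔ C ]) b with b ≟ᶠ a
  ... | yes _ = C
  ... | no  _ = 𝒞 b

  replace-disjoint : ∀ 𝒞 a C → Disjoint 𝒞 → C ⊆ᵥ 𝒞 a → Disjoint (𝒞 [ a ≔ C ])
  replace-disjoint 𝒞 a C disjoint C⊆ b b′ b≢b′ i j e with b ≟ᶠ a | b′ ≟ᶠ a
  ... | yes refl | yes refl = b≢b′ refl
  ... | yes refl | no  b′≢a =
    disjoint a b′ (λ a≡b′ → b′≢a (sym a≡b′)) (proj₁ (C⊆ i)) j (trans (sym (proj₂ (C⊆ i))) e)
  ... | no  b≢a  | yes refl = disjoint b a b≢a i (proj₁ (C⊆ j)) (trans e (proj₂ (C⊆ j)))
  ... | no  _    | no  _    = disjoint b b′ b≢b′ i j e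

  replace-Φ : ∀ 𝒞 a C → weight C < weight (𝒞 a) → Φ (𝒞 [ a ≔ C ]) < Φ 𝒞
  replace-Φ 𝒞 a C lighter = ∑-mono-< lighter-or-same a at-a
    where
    lighter-or-same : ∀ b → weight ((𝒞 [ a ≔ C ]) b) ≤ weight (𝒞 b)
    lighter-or-same b with b ≟ᶠ a
    ... | yes refl = <⇒≤ lighter
    ... | no  _    = ≤-refl
    at-a : weight ((𝒞 [ a ≔ C ]) a) < weight (𝒞 a)
    at-a with a ≟ᶠ a
    ... | yes refl = lighter
    ... | no  a≢a  = ⊥-elim (a≢a refl)

  chord-improvement : ∀ 𝒞 → Disjoint 𝒞 → Chord 𝒞 → Improvement 𝒞
  chord-improvement 𝒞 disjoint (a , i , j , chord) with chord⇒shortening (𝒞 a) i j chord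
  ... | C , shorter , C⊆ =
    𝒞 [ a ≔ C ] , replace-disjoint 𝒞 a C disjoint C⊆ ,
    replace-Φ 𝒞 a C (shorter⇒lighter (𝒞 a) C shorter)

  record BadTriple (𝒞 : Family) : Set where
    field
      cyc           : Fin 3 → Fin k
      cyc-injective : ∀ q q′ → cyc q ≡ cyc q′ → q ≡ q′
      pos           : (q : Fin 3) → Fin (3 + ℓ (𝒞 (cyc q)))
      crossing      : Crossing (cellsAround (𝒞 (cyc 0F)) (pos 0F))
      samePattern   : ∀ q → SamePattern (𝒞 (cyc q)) (𝒞 (cyc 0F)) (pos q) (pos 0F)

  badTriple : ∀ {𝒞} a₁ a₂ a₃ (p₁ : Fin (3 + ℓ (𝒞 a₁))) (p₂ : Fin (3 + ℓ (𝒞 a₂)))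
              (p₃ : Fin (3 + ℓ (𝒞 a₃))) → a₁ ≢ a₂ → a₁ ≢ a₃ → a₂ ≢ a₃ →
              Crossing (cellsAround (𝒞 a₁) p₁) → SamePattern (𝒞 a₂) (𝒞 a₁) p₂ p₁ →
              SamePattern (𝒞 a₃) (𝒞 a₁) p₃ p₁ → BadTriple 𝒞
  badTriple {𝒞} a₁ a₂ a₃ p₁ p₂ p₃ a₁≢a₂ a₁≢a₃ a₂≢a₃ cr same₂ same₃ = record
    { cyc = cyc ; cyc-injective = fin3-injective cyc a₁≢a₂ a₁≢a₃ a₂≢a₃
    ; pos = pos ; crossing = cr ; samePattern = samePattern }
    where
    cyc : Fin 3 → Fin k
    cyc 0F = a₁
    cyc 1F = a₂
    cyc 2F = a₃
    pos : (q : Fin 3) → Fin (3 + ℓ (𝒞 (cyc q)))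
    pos 0F = p₁
    pos 1F = p₂
    pos 2F = p₃
    samePattern : ∀ q → SamePattern (𝒞 (cyc q)) (𝒞 a₁) (pos q) p₁
    samePattern 0F r = refl
    samePattern 1F = same₂
    samePattern 2F = same₃

  badTriple? : ∀ 𝒞 → Dec (BadTriple 𝒞)
  badTriple? 𝒞 = map′
    (λ (a₁ , a₂ , a₃ , p₁ , p₂ , p₃ , a₁≢a₂ , a₁≢a₃ , a₂≢a₃ , cr , same₂ , same₃) →
       badTriple a₁ a₂ a₃ p₁ p₂ p₃ a₁≢a₂ a₁≢a₃ a₂≢a₃ cr same₂ same₃)
    (λ bad → let open BadTriple bad in
       cyc 0F , cyc 1F , cyc 2F , pos 0F , pos 1F , pos 2F ,
       (λ e → 0≢1+n (cyc-injective 0F 1F e)) , (λ e → 0≢1+n (cyc-injective 0F 2F e)) ,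
       (λ e → 0≢1+n (Fin-suc-injective (cyc-injective 1F 2F e))) ,
       crossing , samePattern 1F , samePattern 2F)
    (any? λ a₁ → any? λ a₂ → any? λ a₃ → any? λ p₁ → any? λ p₂ → any? λ p₃ →
       ¬? (a₁ ≟ᶠ a₂) ×-dec ¬? (a₁ ≟ᶠ a₃) ×-dec ¬? (a₂ ≟ᶠ a₃)
       ×-dec crossing? (cellsAround (𝒞 a₁) p₁)
       ×-dec samePattern? (𝒞 a₂) (𝒞 a₁) p₂ p₁ ×-dec samePattern? (𝒞 a₃) (𝒞 a₁) p₃ p₁)

  module TriangleExchange (𝒞 : Family) (disjoint : Disjoint 𝒞) (bad : BadTriple 𝒞) where

    open BadTriple bad

    V : Fin 3 → Fin 3 → Fin n
    V r q = vert (𝒞 (cyc q)) (around r (pos q))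

    V-injective : ∀ r r′ q q′ → V r q ≡ V r′ q′ → q ≡ q′ × r ≡ r′
    V-injective r r′ q q′ e with cyc q ≟ᶠ cyc q′
    ... | no  cq≢cq′ = ⊥-elim (disjoint _ _ cq≢cq′ _ _ e)
    ... | yes cq≡cq′ with cyc-injective q q′ cq≡cq′
    ...   | refl = refl , around-injective (pos q) r r′ (inj (𝒞 (cyc q)) _ _ e)

    V-cell : ∀ r q → f (V r q) ≡ cellsAround (𝒞 (cyc 0F)) (pos 0F) r
    V-cell r q = samePattern q r

    triangleAt : Fin 3 → Cycle G
    triangleAt r = triangle (V r) (λ q q′ e → proj₁ (V-injective r r q q′ e))
      (λ q q′ q≢q′ → clique _ _ (λ e → q≢q′ (proj₁ (V-injective r r q q′ e)))
                                 (trans (V-cell r q) (sym (V-cell r q′))))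

    crossing-at : ∀ q → Crossing (cellsAround (𝒞 (cyc q)) (pos q))
    crossing-at q (e₀ , e₂) = crossing
      ( trans (sym (samePattern q 0F)) (trans e₀ (samePattern q 1F))
      , trans (sym (samePattern q 2F)) (trans e₂ (samePattern q 1F)) )

    triangleAt-mono : ∀ r → Mono (triangleAt r)
    triangleAt-mono r q = trans (V-cell r q) (sym (V-cell r 0F))

    -- a triangle weighs 0, a non-monochromatic cycle at least 1
    exchange-lighter : ∀ q → weight (triangleAt q) < weight (𝒞 (cyc q))
    exchange-lighter q = subst (_< weight (𝒞 (cyc q)))
      (sym (mono-weight (triangleAt q) (triangleAt-mono q)))
      (¬mono-weight (𝒞 (cyc q)) (crossing⇒¬mono (𝒞 (cyc q)) (pos q) (crossing-at q)))

    exchanged : Family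
    exchanged b with any? (λ q → cyc q ≟ᶠ b)
    ... | yes (q , _) = triangleAt q
    ... | no  _       = 𝒞 b

    exchanged-disjoint : Disjoint exchanged
    exchanged-disjoint b b′ b≢b′ i j e with any? (λ q → cyc q ≟ᶠ b) | any? (λ q → cyc q ≟ᶠ b′)
    ... | yes (q , refl) | yes (q′ , refl) = b≢b′ (cong cyc (proj₂ (V-injective q q′ i j e)))
    ... | yes (q , refl) | no  b′∉         = disjoint (cyc i) b′ (λ e′ → b′∉ (i , e′)) _ j e
    ... | no  b∉         | yes (q′ , refl) = disjoint b (cyc j) (λ e′ → b∉ (j , sym e′)) i _ e
    ... | no  _          | no  _           = disjoint b b′ b≢b′ i j e

    exchanged-Φ : Φ exchanged < Φ 𝒞
    exchanged-Φ = ∑-mono-< lighter-or-same (cyc 0F) at-first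
      where
      lighter-or-same : ∀ b → weight (exchanged b) ≤ weight (𝒞 b)
      lighter-or-same b with any? (λ q → cyc q ≟ᶠ b)
      ... | yes (q , refl) = <⇒≤ (exchange-lighter q)
      ... | no  _          = ≤-refl
      at-first : weight (exchanged (cyc 0F)) < weight (𝒞 (cyc 0F))
      at-first with any? (λ q → cyc q ≟ᶠ cyc 0F)
      ... | yes (q , e) = subst (λ b → weight (triangleAt q) < weight (𝒞 b)) e (exchange-lighter q)
      ... | no  ∉       = ⊥-elim (∉ (0F , refl))

    improvement : Improvement 𝒞
    improvement = exchanged , exchanged-disjoint , exchanged-Φ

  -- If the successor p′ of p lies in the cell of p and has the same pattern as p, then p
  -- is not crossing: the predecessor of p′, which is p, shows that the predecessor of p
  -- lies in that cell, and so does the successor p′ itself.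
  successor-samePattern : ∀ C (p p′ : Fin (3 + ℓ C)) → p′ ≡ next p →
                          f (vert C p′) ≡ f (vert C p) → SamePattern C C p p′ →
                          ¬ Crossing (cellsAround C p)
  successor-samePattern C p p′ p′≡next-p sameCell same cr = cr
    ( trans (same 0F) (trans (cong (λ x → f (vert C (prev x))) p′≡next-p)
                             (cong (λ x → f (vert C x)) (prev-next p)))
    , trans (cong (λ x → f (vert C x)) (sym p′≡next-p)) sameCell )

  module Counting (𝒞 : Family) (induced : ∀ a → Induced (𝒞 a)) (noBad : ¬ BadTriple 𝒞)
                  (c : Cell t t′) where

    record Occurrence : Set where
      constructor occurrence
      field
        cyc      : Fin k
        pos      : Fin (3 + ℓ (𝒞 cyc))
        inCell   : f (vert (𝒞 cyc) pos) ≡ c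
        crossing : Crossing (cellsAround (𝒞 cyc) pos)
    open Occurrence

    vertex : Occurrence → Fin n
    vertex o = vert (𝒞 (cyc o)) (pos o)

    -- Each vertex of cross(𝒞, c) is the vertex of an occurrence: it is the tail i or
    -- the head next i of a cross edge, whose other end is outside c.
    toOccurrence : ∀ {y} → InCross f 𝒞 c y → Σ Occurrence λ o → vertex o ≡ y
    toOccurrence (inC , a , i , cross , inj₁ y≡i) =
      occurrence a i (trans (cong f (sym y≡i)) inC) (λ (_ , e₂) → cross (sym e₂)) , sym y≡i
    toOccurrence (inC , a , i , cross , inj₂ y≡next-i) =
      occurrence a (next i) (trans (cong f (sym y≡next-i)) inC)
        (λ (e₀ , _) → cross (trans (sym (cong (λ x → f (vert (𝒞 a) x)) (prev-next i))) e₀)) ,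
      sym y≡next-i

    prevCell nextCell : Occurrence → Cell t t′
    prevCell o = cellsAround (𝒞 (cyc o)) (pos o) 0F
    nextCell o = cellsAround (𝒞 (cyc o)) (pos o) 2F

    near-prev : ∀ o → Near c (prevCell o)
    near-prev o = subst (λ x → Near x (prevCell o)) (inCell o) (local _ _ (edge-prev (𝒞 (cyc o)) (pos o)))

    near-next : ∀ o → Near c (nextCell o)
    near-next o = subst (λ x → Near x (nextCell o)) (inCell o)
                        (local _ _ (adj-sym {G = G} (edge (𝒞 (cyc o)) (pos o))))

    key : Occurrence → ℕ
    key o = toℕ (combine (cellCode c (prevCell o) (near-prev o)) (cellCode c (nextCell o) (near-next o)))

    key< : ∀ o → key o < 625
    key< o = toℕ<n _

    key-injective : ∀ o o′ → key o ≡ key o′ →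
                    SamePattern (𝒞 (cyc o)) (𝒞 (cyc o′)) (pos o) (pos o′)
    key-injective o o′ e
      with combine-injective (cellCode c (prevCell o) (near-prev o)) (cellCode c (nextCell o) (near-next o))
                             (cellCode c (prevCell o′) (near-prev o′)) (cellCode c (nextCell o′) (near-next o′))
                             (toℕ-injective e)
    ... | e₀ , e₂ = λ where
      0F → cellCode-injective c (prevCell o) (prevCell o′) (near-prev o) (near-prev o′) e₀
      1F → trans (inCell o) (sym (inCell o′))
      2F → cellCode-injective c (nextCell o) (nextCell o′) (near-next o) (near-next o′) e₂

    -- Distinct occurrences on one cycle are adjacent, hence consecutive as the cycle is
    -- induced, so they cannot share their key.
    sameCycle : ∀ o o′ → cyc o ≡ cyc o′ → vertex o ≢ vertex o′ → key o ≡ key o′ → ⊥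
    sameCycle o@(occurrence a p inC cr) o′@(occurrence .a p′ inC′ cr′) refl v≢v′ sameKey
      with induced a p p′ (clique _ _ v≢v′ (trans inC (sym inC′)))
    ... | inj₁ p′≡next-p =
      successor-samePattern (𝒞 a) p p′ p′≡next-p (trans inC′ (sym inC)) (key-injective o o′ sameKey) cr
    ... | inj₂ p≡next-p′ =
      successor-samePattern (𝒞 a) p′ p p≡next-p′ (trans inC (sym inC′))
                            (key-injective o′ o (sym sameKey)) cr′

    -- Three occurrences with distinct vertices and one key are on distinct cycles, and
    -- then they form a bad triple.
    noThree : ∀ o₁ o₂ o₃ → vertex o₁ ≢ vertex o₂ → vertex o₁ ≢ vertex o₃ → vertex o₂ ≢ vertex o₃ →
              key o₁ ≡ key o₂ → key o₁ ≡ key o₃ → ⊥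
    noThree o₁ o₂ o₃ v₁≢v₂ v₁≢v₃ v₂≢v₃ k₁≡k₂ k₁≡k₃
      with cyc o₁ ≟ᶠ cyc o₂ | cyc o₁ ≟ᶠ cyc o₃ | cyc o₂ ≟ᶠ cyc o₃
    ... | yes e | _     | _     = sameCycle o₁ o₂ e v₁≢v₂ k₁≡k₂
    ... | no _  | yes e | _     = sameCycle o₁ o₃ e v₁≢v₃ k₁≡k₃
    ... | no _  | no _  | yes e = sameCycle o₂ o₃ e v₂≢v₃ (trans (sym k₁≡k₂) k₁≡k₃)
    ... | no a₁≢a₂ | no a₁≢a₃ | no a₂≢a₃ =
      noBad (badTriple (cyc o₁) (cyc o₂) (cyc o₃) (pos o₁) (pos o₂) (pos o₃) a₁≢a₂ a₁≢a₃ a₂≢a₃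
                       (crossing o₁) (key-injective o₂ o₁ (sym k₁≡k₂)) (key-injective o₃ o₁ (sym k₁≡k₃)))

    open Pigeonhole (λ o o′ → vertex o ≢ vertex o′) key noThree

    occurrences : ∀ {xs} → All (InCross f 𝒞 c) xs → List Occurrence
    occurrences = reduce (λ q → proj₁ (toOccurrence q))

    length-occurrences : ∀ {xs} (qs : All (InCross f 𝒞 c) xs) → length (occurrences qs) ≡ length xs
    length-occurrences []       = refl
    length-occurrences (_ ∷ qs) = cong suc (length-occurrences qs)

    occurrences-All : ∀ {P : Fin n → Set} {xs} (qs : All (InCross f 𝒞 c) xs) → All P xs →
                      All (λ o → P (vertex o)) (occurrences qs)
    occurrences-All []       []         = []
    occurrences-All {P} (q ∷ qs) (py ∷ pys) =
      subst P (sym (proj₂ (toOccurrence q))) py ∷ occurrences-All qs pys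

    occurrences-distinct : ∀ {xs} (qs : All (InCross f 𝒞 c) xs) → AllPairs _≢_ xs →
                           AllPairs (λ o o′ → vertex o ≢ vertex o′) (occurrences qs)
    occurrences-distinct []       []               = []
    occurrences-distinct (q ∷ qs) (y∉ ∷ distinct) =
      subst (λ v → All (λ o′ → v ≢ vertex o′) (occurrences qs)) (sym (proj₂ (toOccurrence q)))
            (occurrences-All qs y∉)
      ∷ occurrences-distinct qs distinct

    -- |cross(𝒞, c)| ≤ 2 · 25² = 1250 ≤ 2304.
    crossBound : CardLe (InCross f 𝒞 c) 2304
    crossBound xs unique qs = begin
      length xs                ≡⟨ sym (length-occurrences qs) ⟩
      length (occurrences qs)  ≤⟨ pigeonhole 625 (occurrences qs) (occurrences-distinct qs unique)
                                             (All.universal key< (occurrences qs)) ⟩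
      625 * 2                  ≤⟨ m≤m+n 1250 1054 ⟩
      2304                     ∎
      where open ≤-Reasoning

  step : ∀ 𝒞 → Disjoint 𝒞 → Improvement 𝒞 ⊎ ((∀ a → Induced (𝒞 a)) × ¬ BadTriple 𝒞)
  step 𝒞 disjoint with chord? 𝒞
  ... | yes chord = inj₁ (chord-improvement 𝒞 disjoint chord)
  ... | no chordless with badTriple? 𝒞
  ...   | yes bad   = inj₁ (TriangleExchange.improvement 𝒞 disjoint bad)
  ...   | no  noBad = inj₂ (chordless⇒induced 𝒞 chordless , noBad)

lemma61 : ∀ {n t t' : ℕ} (G : Graph n) (f : Fin n → Cell t t') → IsCliqueGrid G t t' f →
    (k : ℕ) → Σ (Fin k → Cycle G) Disjoint →
    Σ (Fin k → Cycle G) λ 𝒞 → Disjoint 𝒞 × (∀ a → Induced (𝒞 a))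
    × (∀ (c : Cell t t') → CardLe (InCross f 𝒞 c) 2304)
lemma61 {t = t} {t'} G f grid k (𝒞₀ , disjoint₀) = improve 𝒞₀ disjoint₀ (<-wellFounded (Φ 𝒞₀))
  where
  open CliqueGrid G f grid k
  improve : (𝒞 : Family) → Disjoint 𝒞 → Acc _<_ (Φ 𝒞) →
            Σ Family λ 𝒞 → Disjoint 𝒞 × (∀ a → Induced (𝒞 a))
                           × (∀ (c : Cell t t') → CardLe (InCross f 𝒞 c) 2304)
  improve 𝒞 disjoint (acc smaller) with step 𝒞 disjoint
  ... | inj₁ (𝒞′ , disjoint′ , Φ′<Φ) = improve 𝒞′ disjoint′ (smaller Φ′<Φ)
  ... | inj₂ (induced , noBad)       = 𝒞 , disjoint , induced , Counting.crossBound 𝒞 induced noBad
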